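{- For integers $t\ge6$ and $n\ge t$ we have $\operatorname{Nak}^{\mathcal{S}}(n,t)\ge n-\left\lfloor\frac{t-1}{2}\right\rfloor$.
   Context: A simple game $(N,\mathcal{W})$: $N$ finite, $\mathcal{W}$ a family of subsets (winning coalitions) with $\emptyset\notin\mathcal{W}$, $N\in\mathcal{W}$, closed under supersets; a vetoer is a player in every winning coalition; the Nakamura number is the minimum number of winning coalitions with empty intersection. Write $i\sqsupseteq j$ if for every $S$ with $j\in S\subseteq N\setminus\{i\}$, $S\in\mathcal{W}$ implies $(S\setminus\{j\})\cup\{i\}\in\mathcal{W}$; $i,j$ are equivalent if $i\sqsupseteq j$ and $j\sqsupseteq i$. $\operatorname{Nak}^{\mathcal{S}}(n,t)$ is the maximum Nakamura number of a simple game without vetoers with $n$ players and exactly $t$ equivalence classes. -}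

module Defs where

open import Data.Nat using (ℕ)
open import Data.Fin using (Fin)
open import Data.Fin.Subset using (Subset; _∈_; _∉_; _⊆_; ⊥; ⊤; ⋂; Empty; inside; outside)
open import Data.Vec using (_[_]≔_)
open import Data.List using (List; length)
open import Data.List.Relation.Unary.All using (All)
open import Data.Product using (Σ; _×_; ∃)
open import Relation.Nullary using (¬_)
open import Relation.Binary.PropositionalEquality using (_≡_)
open import Function.Definitions using (Surjective)

record SimpleGame (n : ℕ) : Set₁ where
  field
    W       : Subset n → Set
    ∅-lose  : ¬ W ⊥
    N-win   : W ⊤
    up      : ∀ {S T} → S ⊆ T → W S → W T
open SimpleGame public

Vetoer : ∀ {n} → SimpleGame n → Fin n → Set
Vetoer G i = ∀ S → W G S → i ∈ S

NoVetoer : ∀ {n} → SimpleGame n → Set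
NoVetoer G = ∀ i → ¬ Vetoer G i

IsNakamura : ∀ {n} → SimpleGame n → ℕ → Set
IsNakamura {n} G m =
  (Σ (List (Subset n)) λ Ss → All (W G) Ss × Empty (⋂ Ss) × length Ss ≡ m)
  × (∀ (Ss : List (Subset n)) → All (W G) Ss → Empty (⋂ Ss) → m Data.Nat.≤ length Ss)

_⊒[_]_ : ∀ {n} → Fin n → SimpleGame n → Fin n → Set
i ⊒[ G ] j = ∀ S → j ∈ S → i ∉ S → W G S → W G ((S [ j ]≔ outside) [ i ]≔ inside)

Equiv : ∀ {n} → SimpleGame n → Fin n → Fin n → Set
Equiv G i j = (i ⊒[ G ] j) × (j ⊒[ G ] i)

HasClasses : ∀ {n} → SimpleGame n → ℕ → Set
HasClasses {n} G t =
  Σ (Fin n → Fin t) λ f → Surjective _≡_ _≡_ f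
    × (∀ i j → (Equiv G i j → f i ≡ f j) × (f i ≡ f j → Equiv G i j))

-- Put the players 0, …, p − 1 (p = t − 1) on a path and leave the other n − p players
-- isolated; a coalition wins iff the players outside it form a clique, i.e. a single
-- player or an edge.  Two path players are told apart by a
-- neighbour of one that is not a neighbour of the other (this needs p ≥ 4), an isolated
-- player is strictly more desirable than a path player, and all isolated players are
-- equivalent, which gives t classes.  A family of winning coalitions has empty
-- intersection iff the complements cover every player, so the Nakamura number is the
-- size of a minimum clique cover, n − ⌊p/2⌋: the pairs {2r, 2r+1} and the remaining
-- singletons realise it, and the ⌈p/2⌉ even path players together with the isolated
-- ones form an independent set of that size, each complement containing at most one
-- of them.
module Submission where

open import Defs
open import Data.Empty using (⊥-elim)
open import Data.Fin using (Fin; toℕ; fromℕ<; _≟_)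
open import Data.Fin.Properties using (toℕ-injective; toℕ-fromℕ<; toℕ<n; injective⇒≤)
open import Data.Fin.Subset
  using (Subset; _∈_; _∉_; ⋂; ∁; ⁅_⁆; _∪_; Empty; inside; outside)
open import Data.Fin.Subset.Properties
  using (_∈?_; ∈⊤; ∉⊥; x∈⁅x⁆; x∈⁅y⁆⇒x≡y; x∈p∪q⁺; x∈p∪q⁻; x∈p∩q⁺; x∈p∩q⁻;
         x∈p⇒x∉∁p; x∉∁p⇒x∈p; x∉p⇒x∈∁p)
open import Data.List using (List; []; _∷_; length)
import Data.List as List
open import Data.List.Properties using (length-tabulate)
open import Data.List.Relation.Unary.All using (All; []; _∷_; lookupAny)
import Data.List.Relation.Unary.All.Properties as All
open import Data.List.Relation.Unary.Any using (Any; index)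
open import Data.List.Relation.Unary.Any.Properties using (lookup-index)
open import Data.Nat
  using (ℕ; zero; suc; _+_; _∸_; _⊓_; _≤_; _<_; z≤n; s≤s; s≤s⁻¹; _<?_; ⌊_/2⌋; ⌈_/2⌉)
open import Data.Nat.DivMod using (_/_; m/n≡1+[m∸n]/n)
open import Data.Nat.Properties
  using (suc-injective; +-suc; +-comm; +-cancelʳ-≡; 1+n≢n; n<1+n; n≤1+n;
         ≤-reflexive; ≤-trans; <-trans; ≤-<-trans; <-≤-trans; <⇒≤; <⇒≢; <⇒≱; ≮⇒≥;
         <-asym; <-cmp; +-monoʳ-≤; +-mono-≤-<; ∸-monoˡ-<; ∸-cancelʳ-≡;
         m+n≤o⇒m≤o; m+n≤o⇒n≤o; m+n≤o⇒m≤o∸n; m≤o∸n⇒m+n≤o;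
         m⊓n≤n; m≤n⇒m⊓n≡m; m≥n⇒m⊓n≡n;
         n≡⌊n+n/2⌋; ⌊n/2⌋-mono; ⌊n/2⌋≤⌈n/2⌉; ⌊n/2⌋+⌈n/2⌉≡n)
open import Data.Product using (Σ; ∃; ∃₂; _×_; _,_)
open import Data.Sum using (_⊎_; inj₁; inj₂; [_,_]′)
import Data.Sum as Sum
open import Data.Vec using (tabulate; _[_]≔_)
open import Data.Vec.Properties
  using (lookup⇒[]=; []=⇒lookup; lookup∘update′; lookup∘tabulate; []=-injective;
         []≔-updates; []≔-minimal)
open import Function using (_∘_; id)
open import Function.Definitions using (Surjective)
open import Relation.Binary.Definitions using (Symmetric; tri<; tri≈; tri>)
open import Relation.Binary.PropositionalEquality
open import Relation.Nullary using (¬_; yes; no; does; contradiction)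
open import Relation.Nullary.Decidable using (dec-true; decidable-stable)

private
  variable
    n m : ℕ

∈⋂⁺ : ∀ {x : Fin n} {Ss} → All (x ∈_) Ss → x ∈ ⋂ Ss
∈⋂⁺ []             = ∈⊤
∈⋂⁺ (x∈S ∷ x∈⋂Ss) = x∈p∩q⁺ (x∈S , ∈⋂⁺ x∈⋂Ss)

∈⋂⁻ : ∀ {x : Fin n} Ss → x ∈ ⋂ Ss → All (x ∈_) Ss
∈⋂⁻ []       _   = []
∈⋂⁻ (S ∷ Ss) x∈ with x∈p∩q⁻ S (⋂ Ss) x∈
... | x∈S , x∈⋂Ss = x∈S ∷ ∈⋂⁻ Ss x∈⋂Ss

∈-[]≔⁻ : ∀ {S : Subset n} {i z} b → z ≢ i → z ∈ S [ i ]≔ b → z ∈ S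
∈-[]≔⁻ {S = S} {z = z} b z≢i z∈ =
  lookup⇒[]= z S (trans (sym (lookup∘update′ z≢i S b)) ([]=⇒lookup z∈))

∉-[]≔outside : ∀ (S : Subset n) i → i ∉ S [ i ]≔ outside
∉-[]≔outside S i i∈ with []=-injective i∈ ([]≔-updates S i)
... | ()

swap : Subset n → Fin n → Fin n → Subset n
swap S i j = (S [ j ]≔ outside) [ i ]≔ inside

module _ {S : Subset n} {i j : Fin n} where

  i∈swap : i ∈ swap S i j
  i∈swap = []≔-updates (S [ j ]≔ outside) i

  j∉swap : i ≢ j → j ∉ swap S i j
  j∉swap i≢j = ∉-[]≔outside S j ∘ ∈-[]≔⁻ inside (i≢j ∘ sym)

  ∉swap⁺ : ∀ {z} → z ≢ i → z ≢ j → z ∉ S → z ∉ swap S i j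
  ∉swap⁺ z≢i z≢j z∉S = z∉S ∘ ∈-[]≔⁻ outside z≢j ∘ ∈-[]≔⁻ inside z≢i

  ∉swap⁻ : ∀ {z} → z ∉ swap S i j → z ≡ j ⊎ z ∉ S
  ∉swap⁻ {z} z∉ with z ≟ j | z ≟ i
  ... | yes z≡j | _        = inj₁ z≡j
  ... | no z≢j  | yes refl = contradiction i∈swap z∉
  ... | no z≢j  | no z≢i   =
    inj₂ (z∉ ∘ []≔-minimal _ z i z≢i ∘ []≔-minimal S z j z≢j)

∁⁅_,_⁆ : Fin n → Fin n → Subset n
∁⁅ a , b ⁆ = ∁ (⁅ a ⁆ ∪ ⁅ b ⁆)

∉∁⁅,⁆⁻ : ∀ {a b x : Fin n} → x ∉ ∁⁅ a , b ⁆ → x ≡ a ⊎ x ≡ b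
∉∁⁅,⁆⁻ {a = a} {b} x∉ =
  Sum.map (x∈⁅y⁆⇒x≡y a) (x∈⁅y⁆⇒x≡y b) (x∈p∪q⁻ ⁅ a ⁆ ⁅ b ⁆ (x∉∁p⇒x∈p x∉))

∈∁⁅,⁆ : ∀ {a b x : Fin n} → x ≢ a → x ≢ b → x ∈ ∁⁅ a , b ⁆
∈∁⁅,⁆ x≢a x≢b = x∉p⇒x∈∁p ([ x≢a , x≢b ]′ ∘ ∉∁⁅,⁆⁻ ∘ x∈p⇒x∉∁p)

a∉∁⁅a,b⁆ : ∀ (a b : Fin n) → a ∉ ∁⁅ a , b ⁆
a∉∁⁅a,b⁆ a b = x∈p⇒x∉∁p (x∈p∪q⁺ (inj₁ (x∈⁅x⁆ a)))

b∉∁⁅a,b⁆ : ∀ (a b : Fin n) → b ∉ ∁⁅ a , b ⁆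
b∉∁⁅a,b⁆ a b = x∈p⇒x∉∁p (x∈p∪q⁺ (inj₂ (x∈⁅x⁆ b)))

fibre : (Fin n → Fin m) → Fin m → Subset n
fibre β r = tabulate λ x → does (β x ≟ r)

module _ (β : Fin n → Fin m) where

  ∈fibre⁻ : ∀ {r x} → x ∈ fibre β r → β x ≡ r
  ∈fibre⁻ {r} {x} x∈
    with β x ≟ r | trans (sym (lookup∘tabulate _ x)) ([]=⇒lookup x∈)
  ... | yes βx≡r | _  = βx≡r
  ... | no _     | ()

  ∈fibre : ∀ x → x ∈ fibre β (β x)
  ∈fibre x = lookup⇒[]= x _ (trans (lookup∘tabulate _ x) (dec-true (β x ≟ β x) refl))

⊒-refl : ∀ (G : SimpleGame n) i → i ⊒[ G ] i
⊒-refl G i S i∈S i∉S _ = contradiction i∈S i∉S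

-- Clique-complement games

module CliqueComplementGame
  {n} (E : Fin n → Fin n → Set) (E-sym : Symmetric E)
  (nonclique : ∃₂ λ x y → x ≢ y × ¬ E x y)
  where

  Wins : Subset n → Set
  Wins S = ∀ a b → a ∉ S → b ∉ S → a ≡ b ⊎ E a b

  game : SimpleGame n
  game = record
    { W      = Wins
    ; ∅-lose = λ wins → let (x , y , x≢y , x≁y) = nonclique in
                        [ x≢y , x≁y ]′ (wins x y ∉⊥ ∉⊥)
    ; N-win  = λ a _ a∉⊤ _ → contradiction ∈⊤ a∉⊤
    ; up     = λ S⊆T wins a b a∉T b∉T → wins a b (a∉T ∘ S⊆T) (b∉T ∘ S⊆T)
    }

  ∁⁅,⁆-wins : ∀ {a b} → a ≡ b ⊎ E a b → Wins ∁⁅ a , b ⁆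
  ∁⁅,⁆-wins a≡b⊎a~b x y x∉ y∉ with ∉∁⁅,⁆⁻ x∉ | ∉∁⁅,⁆⁻ y∉
  ... | inj₁ refl | inj₁ refl = inj₁ refl
  ... | inj₂ refl | inj₂ refl = inj₁ refl
  ... | inj₁ refl | inj₂ refl = a≡b⊎a~b
  ... | inj₂ refl | inj₁ refl = Sum.map sym E-sym a≡b⊎a~b

  noVetoer : NoVetoer game
  noVetoer i veto = a∉∁⁅a,b⁆ i i (veto ∁⁅ i , i ⁆ (∁⁅,⁆-wins (inj₁ refl)))

  -- A coalition S ∌ i that wins has i as its only outsider, so the swap has only j outside.
  isolated⇒⊒ : ∀ {i} → (∀ c → ¬ E i c) → ∀ j → i ⊒[ game ] j
  isolated⇒⊒ {i} i-isolated j S _ i∉S wins a b a∉ b∉ =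
    inj₁ (trans (outsider≡j a∉) (sym (outsider≡j b∉)))
    where
    outsider≡j : ∀ {z} → z ∉ swap S i j → z ≡ j
    outsider≡j {z} z∉ = [ id , (λ z∉S → ⊥-elim (¬i≡z⊎i~z (wins i z i∉S z∉S))) ]′ (∉swap⁻ z∉)
      where
      ¬i≡z⊎i~z : ¬ (i ≡ z ⊎ E i z)
      ¬i≡z⊎i~z = [ (λ { refl → z∉ i∈swap }) , i-isolated _ ]′

  ⊒⇒neighbour : ∀ {u v c} → v ⊒[ game ] u → E v c → c ≢ v → c ≢ u → E u c
  ⊒⇒neighbour {u} {v} {c} v⊒u v~c c≢v c≢u with u ≟ v
  ... | yes refl = v~c
  ... | no u≢v
    with v⊒u ∁⁅ v , c ⁆ (∈∁⁅,⁆ u≢v (c≢u ∘ sym)) (a∉∁⁅a,b⁆ v c) (∁⁅,⁆-wins (inj₂ v~c))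
           u c (j∉swap (u≢v ∘ sym)) (∉swap⁺ c≢v c≢u (b∉∁⁅a,b⁆ v c))
  ...   | inj₁ u≡c = contradiction (sym u≡c) c≢u
  ...   | inj₂ u~c = u~c

  Independent : (Fin m → Fin n) → Set
  Independent ι = ∀ r s → ι r ≡ ι s ⊎ E (ι r) (ι s) → r ≡ s

  CliquePartition : (Fin n → Fin m) → Set
  CliquePartition β = ∀ x y → β x ≡ β y → x ≡ y ⊎ E x y

  independent⇒≤length : ∀ {ι : Fin m → Fin n} → Independent ι →
    ∀ Ss → All Wins Ss → Empty (⋂ Ss) → m ≤ length Ss
  independent⇒≤length {ι = ι} ι-independent Ss wins empty =
    injective⇒≤ {f = index ∘ missing} injective
    where
    missing : ∀ r → Any (ι r ∉_) Ss
    missing r = All.¬All⇒Any¬ (ι r ∈?_) Ss (λ ι-r∈all → empty (ι r , ∈⋂⁺ ι-r∈all))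

    injective : ∀ {r s} → index (missing r) ≡ index (missing s) → r ≡ s
    injective {r} {s} same with lookupAny wins (missing r)
    ... | S-wins , ι-r∉S = ι-independent r s (S-wins (ι r) (ι s) ι-r∉S
            (subst (λ k → ι s ∉ List.lookup Ss k) (sym same) (lookup-index (missing s))))

  cliquePartition⇒family : ∀ {β : Fin n → Fin m} → CliquePartition β →
    Σ (List (Subset n)) λ Ss → All Wins Ss × Empty (⋂ Ss) × length Ss ≡ m
  cliquePartition⇒family {m = m} {β = β} β-cliques =
    List.tabulate Cᶜ , All.tabulate⁺ Cᶜ-wins , empty , length-tabulate Cᶜ
    where
    Cᶜ : Fin m → Subset n
    Cᶜ r = ∁ (fibre β r)

    Cᶜ-wins : ∀ r → Wins (Cᶜ r)
    Cᶜ-wins r a b a∉ b∉ = β-cliques a b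
      (trans (∈fibre⁻ β (x∉∁p⇒x∈p a∉)) (sym (∈fibre⁻ β (x∉∁p⇒x∈p b∉))))

    empty : Empty (⋂ (List.tabulate Cᶜ))
    empty (x , x∈⋂) = x∈p⇒x∉∁p (∈fibre β x) (All.tabulate⁻ (∈⋂⁻ _ x∈⋂) (β x))

  independent∧cliquePartition⇒isNakamura : ∀ {ι : Fin m → Fin n} {β : Fin n → Fin m} →
    Independent ι → CliquePartition β → IsNakamura game m
  independent∧cliquePartition⇒isNakamura ι-independent β-cliques =
    cliquePartition⇒family β-cliques , independent⇒≤length ι-independent

-- Halving and paths

⌈n/2⌉≤1+⌊n/2⌋ : ∀ n → ⌈ n /2⌉ ≤ suc ⌊ n /2⌋
⌈n/2⌉≤1+⌊n/2⌋ zero          = z≤n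
⌈n/2⌉≤1+⌊n/2⌋ (suc zero)    = s≤s z≤n
⌈n/2⌉≤1+⌊n/2⌋ (suc (suc n)) = s≤s (⌈n/2⌉≤1+⌊n/2⌋ n)

n≡⌊1+n+n/2⌋ : ∀ n → n ≡ ⌊ suc (n + n) /2⌋
n≡⌊1+n+n/2⌋ zero    = refl
n≡⌊1+n+n/2⌋ (suc n) = cong suc (trans (n≡⌊1+n+n/2⌋ n) (cong ⌊_/2⌋ (sym (+-suc n n))))

m+m≡n+n⇒m≡n : ∀ {m n} → m + m ≡ n + n → m ≡ n
m+m≡n+n⇒m≡n {m} {n} eq = begin
  m             ≡⟨ n≡⌊n+n/2⌋ m ⟩
  ⌊ m + m /2⌋   ≡⟨ cong ⌊_/2⌋ eq ⟩
  ⌊ n + n /2⌋   ≡⟨ n≡⌊n+n/2⌋ n ⟨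
  n             ∎
  where open ≡-Reasoning

1+m+m≢n+n : ∀ {m n} → suc (m + m) ≢ n + n
1+m+m≢n+n {m} {n} eq = 1+n≢n (subst (λ k → suc (k + k) ≡ n + n) m≡n eq)
  where
  m≡n : m ≡ n
  m≡n = trans (n≡⌊1+n+n/2⌋ m) (trans (cong ⌊_/2⌋ eq) (sym (n≡⌊n+n/2⌋ n)))

m<n+n⇒⌊m/2⌋<n : ∀ {m n} → m < n + n → ⌊ m /2⌋ < n
m<n+n⇒⌊m/2⌋<n {m} {n} m<n+n =
  subst (suc ⌊ m /2⌋ ≤_) (sym (n≡⌊1+n+n/2⌋ n)) (⌊n/2⌋-mono (s≤s m<n+n))

n/2≡⌊n/2⌋ : ∀ n → n / 2 ≡ ⌊ n /2⌋
n/2≡⌊n/2⌋ zero          = refl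
n/2≡⌊n/2⌋ (suc zero)    = refl
n/2≡⌊n/2⌋ (suc (suc n)) =
  trans (m/n≡1+[m∸n]/n {suc (suc n)} {2} (s≤s (s≤s z≤n))) (cong suc (n/2≡⌊n/2⌋ n))

Consecutive : ℕ → ℕ → Set
Consecutive x y = suc x ≡ y ⊎ suc y ≡ x

consecutive⇒≢ : ∀ {x y} → Consecutive x y → x ≢ y
consecutive⇒≢ (inj₁ 1+x≡y) refl = 1+n≢n 1+x≡y
consecutive⇒≢ (inj₂ 1+y≡x) refl = 1+n≢n 1+y≡x

¬consecutive[m+m,n+n] : ∀ {m n} → ¬ Consecutive (m + m) (n + n)
¬consecutive[m+m,n+n] {m} {n} (inj₁ eq) = 1+m+m≢n+n {m} {n} eq
¬consecutive[m+m,n+n] {m} {n} (inj₂ eq) = 1+m+m≢n+n {n} {m} eq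

⌊m/2⌋≡⌊n/2⌋⇒m≡n⊎consecutive : ∀ m n → ⌊ m /2⌋ ≡ ⌊ n /2⌋ → m ≡ n ⊎ Consecutive m n
⌊m/2⌋≡⌊n/2⌋⇒m≡n⊎consecutive zero          zero          _  = inj₁ refl
⌊m/2⌋≡⌊n/2⌋⇒m≡n⊎consecutive zero          (suc zero)    _  = inj₂ (inj₁ refl)
⌊m/2⌋≡⌊n/2⌋⇒m≡n⊎consecutive (suc zero)    zero          _  = inj₂ (inj₂ refl)
⌊m/2⌋≡⌊n/2⌋⇒m≡n⊎consecutive (suc zero)    (suc zero)    _  = inj₁ refl
⌊m/2⌋≡⌊n/2⌋⇒m≡n⊎consecutive (suc (suc m)) (suc (suc n)) eq =
  Sum.map (cong (2 +_)) (Sum.map (cong (2 +_)) (cong (2 +_)))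
    (⌊m/2⌋≡⌊n/2⌋⇒m≡n⊎consecutive m n (suc-injective eq))

PathAdj : ℕ → ℕ → ℕ → Set
PathAdj p x y = x < p × y < p × Consecutive x y

PathAdj-sym : ∀ {p x y} → PathAdj p x y → PathAdj p y x
PathAdj-sym (x<p , y<p , xy) = y<p , x<p , Sum.swap xy

pathNeighbour : ∀ {p x} → 2 ≤ p → x < p → ∃ λ c → PathAdj p x c
pathNeighbour {x = zero}  2≤p 0<p  = 1 , 0<p , 2≤p , inj₁ refl
pathNeighbour {x = suc x} _   x+1<p = x , x+1<p , <-trans (n<1+n x) x+1<p , inj₂ refl

Separates : ℕ → ℕ → ℕ → Set
Separates p x y = ∃ λ c → PathAdj p x c × c ≢ y × ¬ PathAdj p y c

separator< : ∀ {p x y} → 4 ≤ p → x < y → y < p → Separates p x y ⊎ Separates p y x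
separator< {x = suc x} {y} _ x+1<y y<p =
  inj₁ (x , (x+1<p , x<p , inj₂ refl) , <⇒≢ x<y , ¬y~x)
  where
  x<y : x < y
  x<y = <-trans (n<1+n x) x+1<y
  x+1<p : suc x < _
  x+1<p = <-trans x+1<y y<p
  x<p : x < _
  x<p = <-trans x<y y<p
  ¬y~x : ¬ PathAdj _ y x
  ¬y~x (_ , _ , inj₁ y+1≡x) = <-asym x<y (subst (y <_) y+1≡x (n<1+n y))
  ¬y~x (_ , _ , inj₂ x+1≡y) = <⇒≢ x+1<y x+1≡y
separator< {x = zero} {suc zero} 4≤p _ y<p =
  inj₂ (2 , (y<p , ≤-trans (s≤s (s≤s (s≤s z≤n))) 4≤p , inj₁ refl) , (λ ()) ,
        λ { (_ , _ , inj₁ ()) ; (_ , _ , inj₂ ()) })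
separator< {x = zero} {suc (suc zero)} 4≤p _ y<p =
  inj₂ (3 , (y<p , 4≤p , inj₁ refl) , (λ ()) ,
        λ { (_ , _ , inj₁ ()) ; (_ , _ , inj₂ ()) })
separator< {x = zero} {suc (suc (suc y))} 4≤p _ _ =
  inj₁ (1 , (≤-trans (s≤s z≤n) 4≤p , ≤-trans (s≤s (s≤s z≤n)) 4≤p , inj₁ refl) , (λ ()) ,
        λ { (_ , _ , inj₁ ()) ; (_ , _ , inj₂ ()) })

separator : ∀ {p x y} → 4 ≤ p → x ≢ y → x < p → y < p → Separates p x y ⊎ Separates p y x
separator {x = x} {y} 4≤p x≢y x<p y<p with <-cmp x y
... | tri< x<y _ _ = separator< 4≤p x<y y<p
... | tri≈ _ x≡y _ = contradiction x≡y x≢y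
... | tri> _ _ y<x = Sum.swap (separator< 4≤p y<x x<p)

module PathWithIsolatedPlayers (n p : ℕ) (4≤p : 4 ≤ p) (p<n : p < n) where

  Adj : Fin n → Fin n → Set
  Adj a b = PathAdj p (toℕ a) (toℕ b)

  isolated : ∀ {i} → p ≤ toℕ i → ∀ c → ¬ Adj i c
  isolated p≤i _ (i<p , _) = <⇒≱ i<p p≤i

  nonclique : ∃₂ λ x y → x ≢ y × ¬ Adj x y
  nonclique = first , last , first≢last , last-isolated first ∘ PathAdj-sym
    where
    first last : Fin n
    first = fromℕ< (≤-<-trans z≤n p<n)
    last  = fromℕ< p<n
    first≢last : first ≢ last
    first≢last eq = <⇒≢ (≤-trans (s≤s z≤n) 4≤p)
      (trans (sym (toℕ-fromℕ< _)) (trans (cong toℕ eq) (toℕ-fromℕ< p<n)))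
    last-isolated : ∀ c → ¬ Adj last c
    last-isolated = isolated (≤-reflexive (sym (toℕ-fromℕ< p<n)))

  open CliqueComplementGame Adj PathAdj-sym nonclique public

  separates⇒⋣ : ∀ {u v} → Separates p (toℕ v) (toℕ u) → ¬ v ⊒[ game ] u
  separates⇒⋣ {u} {v} (c , v~c@(_ , c<p , v-c) , c≢u , ¬u~c) v⊒u =
    ¬u~c (subst (PathAdj p (toℕ u)) toℕ-c′ (⊒⇒neighbour v⊒u v~c′ c′≢v c′≢u))
    where
    c′ : Fin n
    c′ = fromℕ< (<-trans c<p p<n)
    toℕ-c′ : toℕ c′ ≡ c
    toℕ-c′ = toℕ-fromℕ< _
    v~c′ : Adj v c′
    v~c′ = subst (PathAdj p (toℕ v)) (sym toℕ-c′) v~c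
    c′≢v : c′ ≢ v
    c′≢v c′≡v = consecutive⇒≢ v-c (trans (sym (cong toℕ c′≡v)) toℕ-c′)
    c′≢u : c′ ≢ u
    c′≢u c′≡u = c≢u (trans (sym toℕ-c′) (cong toℕ c′≡u))

  path⋣isolated : ∀ {i j} → toℕ i < p → p ≤ toℕ j → ¬ i ⊒[ game ] j
  path⋣isolated i<p p≤j with pathNeighbour (≤-trans (s≤s (s≤s z≤n)) 4≤p) i<p
  ... | c , i~c@(_ , c<p , _) =
    separates⇒⋣ (c , i~c , (λ { refl → <⇒≱ c<p p≤j }) , λ (j<p , _) → <⇒≱ j<p p≤j)

  path-inequivalent : ∀ {i j} → toℕ i < p → toℕ j < p → i ≢ j → ¬ Equiv game i j
  path-inequivalent i<p j<p i≢j (i⊒j , j⊒i) =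
    [ (λ s → separates⇒⋣ s i⊒j) , (λ s → separates⇒⋣ s j⊒i) ]′
      (separator 4≤p (i≢j ∘ toℕ-injective) i<p j<p)

  label : Fin n → ℕ
  label i = toℕ i ⊓ p

  label-path : ∀ {i} → toℕ i < p → label i ≡ toℕ i
  label-path i<p = m≤n⇒m⊓n≡m (<⇒≤ i<p)

  label-isolated : ∀ {i} → p ≤ toℕ i → label i ≡ p
  label-isolated = m≥n⇒m⊓n≡n

  equiv⇒≡label : ∀ {i j} → Equiv game i j → label i ≡ label j
  equiv⇒≡label {i} {j} (i⊒j , j⊒i) with toℕ i <? p | toℕ j <? p
  ... | yes i<p | yes j<p = cong label (decidable-stable (i ≟ j)
                              (λ i≢j → path-inequivalent i<p j<p i≢j (i⊒j , j⊒i)))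
  ... | yes i<p | no  j≮p = contradiction i⊒j (path⋣isolated i<p (≮⇒≥ j≮p))
  ... | no  i≮p | yes j<p = contradiction j⊒i (path⋣isolated j<p (≮⇒≥ i≮p))
  ... | no  i≮p | no  j≮p = trans (label-isolated (≮⇒≥ i≮p)) (sym (label-isolated (≮⇒≥ j≮p)))

  ≡label⇒equiv : ∀ {i j} → label i ≡ label j → Equiv game i j
  ≡label⇒equiv {i} {j} same with toℕ i <? p | toℕ j <? p
  ... | yes i<p | yes j<p = subst (Equiv game i) i≡j (⊒-refl game i , ⊒-refl game i)
    where
    i≡j : i ≡ j
    i≡j = toℕ-injective (trans (sym (label-path i<p)) (trans same (label-path j<p)))
  ... | yes i<p | no  j≮p =
    contradiction (trans (sym (label-path i<p)) (trans same (label-isolated (≮⇒≥ j≮p))))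
                  (<⇒≢ i<p)
  ... | no  i≮p | yes j<p =
    contradiction (trans (sym (label-path j<p)) (trans (sym same) (label-isolated (≮⇒≥ i≮p))))
                  (<⇒≢ j<p)
  ... | no  i≮p | no  j≮p =
    isolated⇒⊒ (isolated (≮⇒≥ i≮p)) j , isolated⇒⊒ (isolated (≮⇒≥ j≮p)) i

  class : Fin n → Fin (suc p)
  class i = fromℕ< (s≤s (m⊓n≤n (toℕ i) p))

  toℕ-class : ∀ i → toℕ (class i) ≡ label i
  toℕ-class i = toℕ-fromℕ< _

  class-surjective : Surjective _≡_ _≡_ class
  class-surjective y = i , λ { refl → toℕ-injective (begin
      toℕ (class i)  ≡⟨ toℕ-class i ⟩
      toℕ i ⊓ p      ≡⟨ cong (_⊓ p) (toℕ-fromℕ< _) ⟩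
      toℕ y ⊓ p      ≡⟨ m≤n⇒m⊓n≡m y≤p ⟩
      toℕ y          ∎) }
    where
    open ≡-Reasoning
    y≤p : toℕ y ≤ p
    y≤p = s≤s⁻¹ (toℕ<n y)
    i : Fin n
    i = fromℕ< (≤-<-trans y≤p p<n)

  hasClasses : HasClasses game (suc p)
  hasClasses = class , class-surjective , λ i j →
    (λ e → toℕ-injective (trans (toℕ-class i) (trans (equiv⇒≡label e) (sym (toℕ-class j))))) ,
    (λ e → ≡label⇒equiv (trans (sym (toℕ-class i)) (trans (cong toℕ e) (toℕ-class j))))

  k q : ℕ
  k = ⌊ p /2⌋
  q = ⌈ p /2⌉

  k+q≡p : k + q ≡ p
  k+q≡p = ⌊n/2⌋+⌈n/2⌉≡n p

  r<q⇒r+r<p : ∀ {r} → r < q → r + r < p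
  r<q⇒r+r<p r<q = subst (_ <_) k+q≡p (+-mono-≤-< (s≤s⁻¹ (≤-trans r<q (⌈n/2⌉≤1+⌊n/2⌋ p))) r<q)

  q≤r⇒p≤r+k : ∀ {r} → q ≤ r → p ≤ r + k
  q≤r⇒p≤r+k {r} q≤r = subst₂ _≤_ k+q≡p (+-comm k r) (+-monoʳ-≤ k q≤r)

  k+k≤p : k + k ≤ p
  k+k≤p = subst (k + k ≤_) k+q≡p (+-monoʳ-≤ k (⌊n/2⌋≤⌈n/2⌉ p))

  k≤n∸k : k ≤ n ∸ k
  k≤n∸k = m+n≤o⇒m≤o∸n k (≤-trans k+k≤p (<⇒≤ p<n))

  -- the even path vertices followed by the isolated players
  independentℕ : ℕ → ℕ
  independentℕ r with r <? q
  ... | yes _ = r + r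
  ... | no  _ = r + k

  independentℕ-cases : ∀ r → (independentℕ r ≡ r + r × r + r < p)
                           ⊎ (independentℕ r ≡ r + k × p ≤ r + k)
  independentℕ-cases r with r <? q
  ... | yes r<q = inj₁ (refl , r<q⇒r+r<p r<q)
  ... | no  r≮q = inj₂ (refl , q≤r⇒p≤r+k (≮⇒≥ r≮q))

  independentℕ-bound : ∀ {r} → r < n ∸ k → independentℕ r < n
  independentℕ-bound {r} r<n∸k with independentℕ-cases r
  ... | inj₁ (eq , r+r<p) = subst (_< n) (sym eq) (<-trans r+r<p p<n)
  ... | inj₂ (eq , _)     = subst (_< n) (sym eq) (m≤o∸n⇒m+n≤o (suc r) k≤n r<n∸k)
    where
    k≤n : k ≤ n
    k≤n = ≤-trans (m+n≤o⇒m≤o k k+k≤p) (<⇒≤ p<n)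

  independentℕ-injective : ∀ {r s} → independentℕ r ≡ independentℕ s → r ≡ s
  independentℕ-injective {r} {s} eq with independentℕ-cases r | independentℕ-cases s
  ... | inj₁ (eq-r , _) | inj₁ (eq-s , _) = m+m≡n+n⇒m≡n (trans (sym eq-r) (trans eq eq-s))
  ... | inj₂ (eq-r , _) | inj₂ (eq-s , _) = +-cancelʳ-≡ k r s (trans (sym eq-r) (trans eq eq-s))
  ... | inj₁ (eq-r , r+r<p) | inj₂ (eq-s , p≤s+k) =
    contradiction (trans (sym eq-r) (trans eq eq-s)) (<⇒≢ (<-≤-trans r+r<p p≤s+k))
  ... | inj₂ (eq-r , p≤r+k) | inj₁ (eq-s , s+s<p) =
    contradiction (trans (sym eq-s) (trans (sym eq) eq-r)) (<⇒≢ (<-≤-trans s+s<p p≤r+k))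

  independentℕ-nonadjacent : ∀ {r s} → ¬ PathAdj p (independentℕ r) (independentℕ s)
  independentℕ-nonadjacent {r} {s} (ι-r<p , ι-s<p , consecutive)
    with independentℕ-cases r | independentℕ-cases s
  ... | inj₂ (eq-r , p≤r+k) | _ = <⇒≱ (subst (_< p) eq-r ι-r<p) p≤r+k
  ... | inj₁ _ | inj₂ (eq-s , p≤s+k) = <⇒≱ (subst (_< p) eq-s ι-s<p) p≤s+k
  ... | inj₁ (eq-r , _) | inj₁ (eq-s , _) =
    ¬consecutive[m+m,n+n] {r} {s} (subst₂ Consecutive eq-r eq-s consecutive)

  -- the pairs {2r, 2r+1} for r < k, then singletons
  blockℕ : ℕ → ℕ
  blockℕ v with v <? k + k
  ... | yes _ = ⌊ v /2⌋
  ... | no  _ = v ∸ k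

  blockℕ-cases : ∀ v → (blockℕ v ≡ ⌊ v /2⌋ × v < k + k) ⊎ (blockℕ v ≡ v ∸ k × k + k ≤ v)
  blockℕ-cases v with v <? k + k
  ... | yes v<2k = inj₁ (refl , v<2k)
  ... | no  v≮2k = inj₂ (refl , ≮⇒≥ v≮2k)

  blockℕ-bound : ∀ {v} → v < n → blockℕ v < n ∸ k
  blockℕ-bound {v} v<n with blockℕ-cases v
  ... | inj₁ (eq , v<2k) = subst (_< n ∸ k) (sym eq) (<-≤-trans (m<n+n⇒⌊m/2⌋<n v<2k) k≤n∸k)
  ... | inj₂ (eq , 2k≤v) = subst (_< n ∸ k) (sym eq) (∸-monoˡ-< v<n (m+n≤o⇒n≤o k 2k≤v))

  blockℕ-fibre : ∀ {u v} → blockℕ u ≡ blockℕ v → u ≡ v ⊎ PathAdj p u v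
  blockℕ-fibre {u} {v} eq with blockℕ-cases u | blockℕ-cases v
  ... | inj₁ (eq-u , u<2k) | inj₁ (eq-v , v<2k) =
    Sum.map₂ (λ c → <-≤-trans u<2k k+k≤p , <-≤-trans v<2k k+k≤p , c)
      (⌊m/2⌋≡⌊n/2⌋⇒m≡n⊎consecutive u v (trans (sym eq-u) (trans eq eq-v)))
  ... | inj₂ (eq-u , 2k≤u) | inj₂ (eq-v , 2k≤v) =
    inj₁ (∸-cancelʳ-≡ (m+n≤o⇒n≤o k 2k≤u) (m+n≤o⇒n≤o k 2k≤v) (trans (sym eq-u) (trans eq eq-v)))
  ... | inj₁ (eq-u , u<2k) | inj₂ (eq-v , 2k≤v) =
    contradiction (trans (sym eq-u) (trans eq eq-v))
      (<⇒≢ (<-≤-trans (m<n+n⇒⌊m/2⌋<n u<2k) (m+n≤o⇒m≤o∸n k 2k≤v)))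
  ... | inj₂ (eq-u , 2k≤u) | inj₁ (eq-v , v<2k) =
    contradiction (trans (sym eq-v) (trans (sym eq) eq-u))
      (<⇒≢ (<-≤-trans (m<n+n⇒⌊m/2⌋<n v<2k) (m+n≤o⇒m≤o∸n k 2k≤u)))

  independentSet : Fin (n ∸ k) → Fin n
  independentSet r = fromℕ< (independentℕ-bound (toℕ<n r))

  independentSet-independent : Independent independentSet
  independentSet-independent r s =
    [ toℕ-injective ∘ independentℕ-injective ∘ toℕ-cong
    , ⊥-elim ∘ independentℕ-nonadjacent ∘ subst₂ (PathAdj p) (toℕ-fromℕ< _) (toℕ-fromℕ< _)
    ]′
    where
    toℕ-cong : independentSet r ≡ independentSet s → independentℕ (toℕ r) ≡ independentℕ (toℕ s)
    toℕ-cong eq = trans (sym (toℕ-fromℕ< _)) (trans (cong toℕ eq) (toℕ-fromℕ< _))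

  block : Fin n → Fin (n ∸ k)
  block v = fromℕ< (blockℕ-bound (toℕ<n v))

  block-cliquePartition : CliquePartition block
  block-cliquePartition u v eq = Sum.map₁ toℕ-injective (blockℕ-fibre
    (trans (sym (toℕ-fromℕ< _)) (trans (cong toℕ eq) (toℕ-fromℕ< _))))

  isNakamura : IsNakamura game (n ∸ k)
  isNakamura =
    independent∧cliquePartition⇒isNakamura independentSet-independent block-cliquePartition

proposition7 : ∀ (n t : ℕ) → 6 ≤ t → t ≤ n →
    Σ (SimpleGame n) λ G → NoVetoer G × HasClasses G t ×
      Σ ℕ λ m → IsNakamura G m × (n ∸ ((t ∸ 1) / 2) ≤ m)
proposition7 n (suc p) (s≤s 5≤p) p<n =
  game , noVetoer , hasClasses , n ∸ k , isNakamura , ≤-reflexive (cong (n ∸_) (n/2≡⌊n/2⌋ p))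
  where open PathWithIsolatedPlayers n p (≤-trans (n≤1+n 4) 5≤p) p<n
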